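{- As formal power series in $q$, \[ \sum_{n\geq0}\frac{q^{n(n+1)}\,(- q;q^2)_n}{(q;q)_{2n+1}} = \frac{(-q^2;q^2)_\infty}{( q;q^2)_\infty}. \]
   Context: $(a;q)_k=\prod_{j=0}^{k-1}(1-aq^j)$, $(a;q)_0=1$, $(a;q)_\infty=\prod_{j\ge0}(1-aq^j)$, and likewise with base $q^2$. -}

module Defs where

open import Data.Nat as ℕ using (ℕ; zero; suc; _∸_; _≟_)
open import Data.Integer using (ℤ; 0ℤ; 1ℤ; _+_; _*_; -_)
open import Data.List using (List; []; _∷_; upTo; map; zipWith; length; foldr)
open import Relation.Nullary using (yes; no)

-- Formal power series in q with integer coefficients: n ↦ coefficient of q^n.
Series : Set
Series = ℕ → ℤ

sumℤ : List ℤ → ℤ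
sumℤ = foldr _+_ 0ℤ

qpow : ℕ → Series
qpow k n with n ≟ k
... | yes _ = 1ℤ
... | no  _ = 0ℤ

one : Series
one = qpow 0

_⊕_ : Series → Series → Series
(f ⊕ g) n = f n + g n

_·_ : ℤ → Series → Series
(c · f) n = c * f n

_⊛_ : Series → Series → Series
(f ⊛ g) n = sumℤ (map (λ k → f k * g (n ∸ k)) (upTo (suc n)))

infixl 7 _⊛_

-- Multiplicative inverse of a series with constant term 1:
-- g_0 = 1, g_n = - Σ_{k=1}^{n} f_k g_{n-k}.
-- invRev f n = [g_n, g_{n-1}, ..., g_0].
invRev : Series → ℕ → List ℤ
invRev f zero = 1ℤ ∷ []
invRev f (suc n) =
  let cs = invRev f n in
  (- sumℤ (zipWith (λ i c → f (suc i) * c) (upTo (length cs)) cs)) ∷ cs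

headOr0 : List ℤ → ℤ
headOr0 [] = 0ℤ
headOr0 (x ∷ _) = x

inv : Series → Series
inv f n = headOr0 (invRev f n)

-- f / g for g with constant term 1
_⊘_ : Series → Series → Series
f ⊘ g = f ⊛ inv g

prodTo : (ℕ → Series) → ℕ → Series
prodTo F zero = one
prodTo F (suc k) = prodTo F k ⊛ F k

-- q-Pochhammer (a;Q)_k with a = c·q^s and base Q = q^b :
-- ∏_{j=0}^{k-1} (1 - c q^{s + b j})
poch : ℤ → ℕ → ℕ → ℕ → Series
poch c s b k = prodTo (λ j → one ⊕ ((- c) · qpow (s ℕ.+ b ℕ.* j))) k

-- (a;Q)_∞ with a = c·q^s, Q = q^b, for s ≥ 1, b ≥ 1: the coefficient of q^n
-- is that of the finite product over j ≤ n (all later factors are ≡ 1 mod q^{n+1}),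
-- i.e. the (eventually constant) limit of the partial products.
pochInf : ℤ → ℕ → ℕ → Series
pochInf c s b n = poch c s b (suc n) n

-- Σ_{n≥0} F n for a family with F n ≡ 0 mod q^n (ord (F n) ≥ n):
-- the coefficient of q^m is Σ_{n=0}^{m} (F n)_m.
sumSeries : (ℕ → Series) → Series
sumSeries F m = sumℤ (map (λ n → F n m) (upTo (suc m)))

lhs : Series
lhs = sumSeries (λ n →
  (qpow (n ℕ.* suc n) ⊛ poch (- 1ℤ) 1 2 n) ⊘ poch 1ℤ 1 1 (suc (2 ℕ.* n)))

rhs : Series
rhs = pochInf (- 1ℤ) 2 2 ⊘ pochInf 1ℤ 1 2

module Submission where

open import Algebra.Bundles using (CommutativeRing)
import Algebra.Solver.Ring.AlmostCommutativeRing as ACR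
open import Data.Empty using (⊥-elim)
open import Data.Integer as ℤ using (ℤ; 0ℤ; 1ℤ; _+_; _*_; -_)
import Data.Integer.Properties as ℤₚ
open import Data.Integer.Tactic.RingSolver using (solve-∀)
open import Data.List using (_∷_; map; upTo; zipWith; length; applyUpTo)
import Data.List.Properties as Listₚ
open import Data.Maybe using (Maybe; just; nothing)
open import Data.Nat as ℕ using (ℕ; zero; suc; _∸_; _<_; _≤_; _≟_; z≤n; s≤s)
import Data.Nat.Properties as ℕₚ
import Data.Nat.Tactic.RingSolver as ℕ-Solver
open import Data.Product using (_,_)
open import Data.Sum using (inj₁; inj₂)
open import Function using (_∘_; id)
open import Level using (0ℓ)
open import Relation.Binary.PropositionalEquality
import Relation.Binary.Reasoning.Setoid
open import Relation.Nullary using (Dec; yes; no)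
open import Defs

-- Let u_k(n) = q^(n(n+1)+2kn) (-q;q²)_n / ((q²;q²)_n (q^(2k+3);q²)_n) and S_k = Σ_n u_k(n), so that
-- the left side is S_0/(1-q). Comparing consecutive terms in n and in k,
--   u_{k+1}(n) (1 - q^(2k+3+2n)) = q^(2n) u_k(n) (1 - q^(2k+3)),
-- shows that (1 - q^(2k+3)) u_k(n) - (1 + q^(2k+2)) u_{k+1}(n) = w_k(n) - w_k(n+1) with
-- w_k(n) = (1 - q^(2k+3)) (1 - q^(2n)) u_k(n). Since w_k(0) = 0 and u_k(n) ≡ 0 mod q^n, summing gives
-- (1 - q^(2k+3)) S_k = (1 + q^(2k+2)) S_{k+1}, hence (q³;q²)_J S_0 = (-q²;q²)_J S_J; as S_J ≡ 1 mod q^J,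
-- letting J grow and dividing by 1 - q gives the right side.
-- Each coefficient is computed modulo q^K for a large enough K: there every sum and product is
-- finite, and series modulo q^K form a commutative ring in which the ring solver does the algebra.

tail : Series → Series
tail f n = f (suc n)

zeroSeries : Series
zeroSeries _ = 0ℤ

∑< : (ℕ → ℤ) → ℕ → ℤ
∑< g zero    = 0ℤ
∑< g (suc n) = g 0 + ∑< (g ∘ suc) n

∑<-suc : ∀ g n → ∑< g (suc n) ≡ ∑< g n + g n
∑<-suc g zero    = trans (ℤₚ.+-identityʳ (g 0)) (sym (ℤₚ.+-identityˡ (g 0)))
∑<-suc g (suc n) = trans (cong (g 0 +_) (∑<-suc (g ∘ suc) n))
  (sym (ℤₚ.+-assoc (g 0) (∑< (g ∘ suc) n) (g (suc n))))

sumℤ-applyUpTo : ∀ g n → sumℤ (applyUpTo g n) ≡ ∑< g n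
sumℤ-applyUpTo g zero    = refl
sumℤ-applyUpTo g (suc n) = cong (g 0 +_) (sumℤ-applyUpTo (g ∘ suc) n)

sumℤ-map-upTo : ∀ g n → sumℤ (map g (upTo n)) ≡ ∑< g n
sumℤ-map-upTo g n = trans (cong sumℤ (Listₚ.map-upTo g n)) (sumℤ-applyUpTo g n)

⊛-coeff-zero : ∀ f g → (f ⊛ g) 0 ≡ f 0 * g 0
⊛-coeff-zero f g = ℤₚ.+-identityʳ _

⊛-coeff-suc : ∀ f g n → (f ⊛ g) (suc n) ≡ f 0 * g (suc n) + (tail f ⊛ g) n
⊛-coeff-suc f g n = trans (sumℤ-map-upTo (λ k → f k * g (suc n ∸ k)) (suc (suc n)))
  (cong (f 0 * g (suc n) +_) (sym (sumℤ-map-upTo (λ k → f (suc k) * g (n ∸ k)) (suc n))))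

⊛-coeff-sucʳ : ∀ f g n → (f ⊛ g) (suc n) ≡ (f ⊛ tail g) n + f (suc n) * g 0
⊛-coeff-sucʳ f g zero
  rewrite ⊛-coeff-suc f g 0 | ⊛-coeff-zero (tail f) g | ⊛-coeff-zero f (tail g) = refl
⊛-coeff-sucʳ f g (suc n)
  rewrite ⊛-coeff-suc f g (suc n) | ⊛-coeff-sucʳ (tail f) g n | ⊛-coeff-suc f (tail g) n =
  sym (ℤₚ.+-assoc (f 0 * g (suc (suc n))) ((tail f ⊛ tail g) n) (f (suc (suc n)) * g 0))

⊛-congˡ : ∀ {f f′} g → f ≗ f′ → f ⊛ g ≗ f′ ⊛ g
⊛-congˡ {f} {f′} g f≗f′ zero = trans (⊛-coeff-zero f g)
  (trans (cong (_* g 0) (f≗f′ 0)) (sym (⊛-coeff-zero f′ g)))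
⊛-congˡ {f} {f′} g f≗f′ (suc n) = trans (⊛-coeff-suc f g n)
  (trans (cong₂ (λ a b → a * g (suc n) + b) (f≗f′ 0) (⊛-congˡ g (f≗f′ ∘ suc) n))
         (sym (⊛-coeff-suc f′ g n)))

⊛-comm : ∀ f g → f ⊛ g ≗ g ⊛ f
⊛-comm f g zero rewrite ⊛-coeff-zero f g | ⊛-coeff-zero g f = ℤₚ.*-comm (f 0) (g 0)
⊛-comm f g (suc n) rewrite ⊛-coeff-suc f g n | ⊛-coeff-sucʳ g f n | ⊛-comm (tail f) g n =
  trans (ℤₚ.+-comm (f 0 * g (suc n)) ((g ⊛ tail f) n)) (cong ((g ⊛ tail f) n +_) (ℤₚ.*-comm (f 0) (g (suc n))))

⊛-congʳ : ∀ f {g g′} → g ≗ g′ → f ⊛ g ≗ f ⊛ g′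
⊛-congʳ f {g} {g′} g≗g′ n = begin
  (f ⊛ g) n   ≡⟨ ⊛-comm f g n ⟩
  (g ⊛ f) n   ≡⟨ ⊛-congˡ f g≗g′ n ⟩
  (g′ ⊛ f) n  ≡⟨ ⊛-comm g′ f n ⟩
  (f ⊛ g′) n  ∎
  where open ≡-Reasoning

⊛-cong : ∀ {f f′ g g′} → f ≗ f′ → g ≗ g′ → f ⊛ g ≗ f′ ⊛ g′
⊛-cong {f} {f′} {g} {g′} f≗f′ g≗g′ n = trans (⊛-congˡ g f≗f′ n) (⊛-congʳ f′ g≗g′ n)

⊛-distribʳ-⊕ : ∀ f g h → (f ⊕ g) ⊛ h ≗ (f ⊛ h) ⊕ (g ⊛ h)
⊛-distribʳ-⊕ f g h zero
  rewrite ⊛-coeff-zero (f ⊕ g) h | ⊛-coeff-zero f h | ⊛-coeff-zero g h = ℤₚ.*-distribʳ-+ (h 0) (f 0) (g 0)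
⊛-distribʳ-⊕ f g h (suc n)
  rewrite ⊛-coeff-suc (f ⊕ g) h n | ⊛-coeff-suc f h n | ⊛-coeff-suc g h n | ⊛-distribʳ-⊕ (tail f) (tail g) h n =
  lemma (f 0) (g 0) (h (suc n)) ((tail f ⊛ h) n) ((tail g ⊛ h) n)
  where
  lemma : ∀ a b c x y → (a + b) * c + (x + y) ≡ a * c + x + (b * c + y)
  lemma = solve-∀

·-⊛-assoc : ∀ c f g → (c · f) ⊛ g ≗ c · (f ⊛ g)
·-⊛-assoc c f g zero
  rewrite ⊛-coeff-zero (c · f) g | ⊛-coeff-zero f g = ℤₚ.*-assoc c (f 0) (g 0)
·-⊛-assoc c f g (suc n)
  rewrite ⊛-coeff-suc (c · f) g n | ⊛-coeff-suc f g n | ·-⊛-assoc c (tail f) g n =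
  lemma c (f 0) (g (suc n)) ((tail f ⊛ g) n)
  where
  lemma : ∀ c a b x → c * a * b + c * x ≡ c * (a * b + x)
  lemma = solve-∀

⊛-assoc : ∀ f g h → (f ⊛ g) ⊛ h ≗ f ⊛ (g ⊛ h)
⊛-assoc f g h zero
  rewrite ⊛-coeff-zero (f ⊛ g) h | ⊛-coeff-zero f (g ⊛ h) | ⊛-coeff-zero f g | ⊛-coeff-zero g h =
  ℤₚ.*-assoc (f 0) (g 0) (h 0)
⊛-assoc f g h (suc n) = begin
  ((f ⊛ g) ⊛ h) (suc n)
    ≡⟨ ⊛-coeff-suc (f ⊛ g) h n ⟩
  (f ⊛ g) 0 * h (suc n) + (tail (f ⊛ g) ⊛ h) n
    ≡⟨ cong₂ (λ a b → a * h (suc n) + b) (⊛-coeff-zero f g) (⊛-congˡ h (⊛-coeff-suc f g) n) ⟩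
  f 0 * g 0 * h (suc n) + (((f 0 · tail g) ⊕ (tail f ⊛ g)) ⊛ h) n
    ≡⟨ cong (f 0 * g 0 * h (suc n) +_) (⊛-distribʳ-⊕ (f 0 · tail g) (tail f ⊛ g) h n) ⟩
  f 0 * g 0 * h (suc n) + (((f 0 · tail g) ⊛ h) n + ((tail f ⊛ g) ⊛ h) n)
    ≡⟨ cong₂ (λ a b → f 0 * g 0 * h (suc n) + (a + b)) (·-⊛-assoc (f 0) (tail g) h n) (⊛-assoc (tail f) g h n) ⟩
  f 0 * g 0 * h (suc n) + (f 0 * (tail g ⊛ h) n + (tail f ⊛ (g ⊛ h)) n)
    ≡⟨ lemma (f 0) (g 0) (h (suc n)) ((tail g ⊛ h) n) ((tail f ⊛ (g ⊛ h)) n) ⟩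
  f 0 * (g 0 * h (suc n) + (tail g ⊛ h) n) + (tail f ⊛ (g ⊛ h)) n
    ≡⟨ cong (λ a → f 0 * a + (tail f ⊛ (g ⊛ h)) n) (sym (⊛-coeff-suc g h n)) ⟩
  f 0 * (g ⊛ h) (suc n) + (tail f ⊛ (g ⊛ h)) n
    ≡⟨ sym (⊛-coeff-suc f (g ⊛ h) n) ⟩
  (f ⊛ (g ⊛ h)) (suc n) ∎
  where
  open ≡-Reasoning
  lemma : ∀ a b c x y → a * b * c + (a * x + y) ≡ a * (b * c + x) + y
  lemma = solve-∀

⊛-zeroˡ : ∀ f → zeroSeries ⊛ f ≗ zeroSeries
⊛-zeroˡ f zero    = ⊛-coeff-zero zeroSeries f
⊛-zeroˡ f (suc n) rewrite ⊛-coeff-suc zeroSeries f n | ⊛-zeroˡ f n = refl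

⊛-identityˡ : ∀ f → one ⊛ f ≗ f
⊛-identityˡ f zero rewrite ⊛-coeff-zero one f = ℤₚ.*-identityˡ (f 0)
⊛-identityˡ f (suc n) rewrite ⊛-coeff-suc one f n | ⊛-zeroˡ f n =
  trans (ℤₚ.+-identityʳ (1ℤ * f (suc n))) (ℤₚ.*-identityˡ (f (suc n)))

⊛-identityʳ : ∀ f → f ⊛ one ≗ f
⊛-identityʳ f n = trans (⊛-comm f one n) (⊛-identityˡ f n)

∑ₛ : (ℕ → Series) → ℕ → Series
∑ₛ F zero    = zeroSeries
∑ₛ F (suc N) = ∑ₛ F N ⊕ F N

∑ₛ-coeff : ∀ F N m → ∑ₛ F N m ≡ ∑< (λ n → F n m) N
∑ₛ-coeff F zero    m = refl
∑ₛ-coeff F (suc N) m = trans (cong (_+ F N m) (∑ₛ-coeff F N m)) (sym (∑<-suc (λ n → F n m) N))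

sumSeries≡∑ₛ : ∀ F m → sumSeries F m ≡ ∑ₛ F (suc m) m
sumSeries≡∑ₛ F m = trans (sumℤ-map-upTo (λ n → F n m) (suc m)) (sym (∑ₛ-coeff F (suc m) m))

invRev≡applyUpTo : ∀ f n → invRev f n ≡ applyUpTo (λ i → inv f (n ∸ i)) (suc n)
invRev≡applyUpTo f zero    = refl
invRev≡applyUpTo f (suc n) = cong (inv f (suc n) ∷_) (invRev≡applyUpTo f n)

zipWith-applyUpTo : ∀ {A B C : Set} (z : A → B → C) (a : ℕ → A) (b : ℕ → B) n →
  zipWith z (applyUpTo a n) (applyUpTo b n) ≡ applyUpTo (λ i → z (a i) (b i)) n
zipWith-applyUpTo z a b zero    = refl
zipWith-applyUpTo z a b (suc n) = cong (z (a 0) (b 0) ∷_) (zipWith-applyUpTo z (a ∘ suc) (b ∘ suc) n)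

inv-suc : ∀ f n → inv f (suc n) ≡ - (tail f ⊛ inv f) n
inv-suc f n = begin
  inv f (suc n)
    ≡⟨ cong (λ cs → - sumℤ (zipWith scale (upTo (length cs)) cs)) (invRev≡applyUpTo f n) ⟩
  - sumℤ (zipWith scale (upTo (length (applyUpTo g (suc n)))) (applyUpTo g (suc n)))
    ≡⟨ cong (λ m → - sumℤ (zipWith scale (upTo m) (applyUpTo g (suc n)))) (Listₚ.length-applyUpTo g (suc n)) ⟩
  - sumℤ (zipWith scale (applyUpTo id (suc n)) (applyUpTo g (suc n)))
    ≡⟨ cong (λ l → - sumℤ l) (zipWith-applyUpTo scale id g (suc n)) ⟩
  - sumℤ (applyUpTo (λ i → f (suc i) * inv f (n ∸ i)) (suc n))
    ≡⟨ cong -_ (sumℤ-applyUpTo (λ i → f (suc i) * inv f (n ∸ i)) (suc n)) ⟩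
  - ∑< (λ i → f (suc i) * inv f (n ∸ i)) (suc n)
    ≡⟨ cong -_ (sym (sumℤ-map-upTo (λ i → f (suc i) * inv f (n ∸ i)) (suc n))) ⟩
  - (tail f ⊛ inv f) n ∎
  where
  open ≡-Reasoning
  scale : ℕ → ℤ → ℤ
  scale i c = f (suc i) * c
  g : ℕ → ℤ
  g i = inv f (n ∸ i)

⊛-inverseʳ : ∀ f → f 0 ≡ 1ℤ → f ⊛ inv f ≗ one
⊛-inverseʳ f f₀≡1 zero rewrite ⊛-coeff-zero f (inv f) | f₀≡1 = refl
⊛-inverseʳ f f₀≡1 (suc n) rewrite ⊛-coeff-suc f (inv f) n | f₀≡1 | inv-suc f n =
  lemma ((tail f ⊛ inv f) n)
  where
  lemma : ∀ x → 1ℤ * (- x) + x ≡ 0ℤ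
  lemma = solve-∀

qpow-≡ : ∀ k → qpow k k ≡ 1ℤ
qpow-≡ k with k ≟ k
... | yes _  = refl
... | no k≢k = ⊥-elim (k≢k refl)

qpow-≢ : ∀ {k n} → n ≢ k → qpow k n ≡ 0ℤ
qpow-≢ {k} {n} n≢k with n ≟ k
... | yes n≡k = ⊥-elim (n≢k n≡k)
... | no _    = refl

qpow-suc-suc : ∀ k n → qpow (suc k) (suc n) ≡ qpow k n
qpow-suc-suc k n = by-cases (n ≟ k)
  where
  by-cases : Dec (n ≡ k) → qpow (suc k) (suc n) ≡ qpow k n
  by-cases (yes refl) = trans (qpow-≡ (suc n)) (sym (qpow-≡ n))
  by-cases (no n≢k)   = trans (qpow-≢ (n≢k ∘ ℕₚ.suc-injective)) (sym (qpow-≢ n≢k))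

qpow-+ : ∀ a b → qpow a ⊛ qpow b ≗ qpow (a ℕ.+ b)
qpow-+ zero    b n       = ⊛-identityˡ (qpow b) n
qpow-+ (suc a) b zero    = ⊛-coeff-zero (qpow (suc a)) (qpow b)
qpow-+ (suc a) b (suc n) = begin
  (qpow (suc a) ⊛ qpow b) (suc n)           ≡⟨ ⊛-coeff-suc (qpow (suc a)) (qpow b) n ⟩
  0ℤ + (tail (qpow (suc a)) ⊛ qpow b) n    ≡⟨ ℤₚ.+-identityˡ _ ⟩
  (tail (qpow (suc a)) ⊛ qpow b) n         ≡⟨ ⊛-congˡ (qpow b) (qpow-suc-suc a) n ⟩
  (qpow a ⊛ qpow b) n                      ≡⟨ qpow-+ a b n ⟩
  qpow (a ℕ.+ b) n                         ≡⟨ qpow-suc-suc (a ℕ.+ b) n ⟨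
  qpow (suc a ℕ.+ b) (suc n)               ∎
  where open ≡-Reasoning

qpow-≗ : ∀ {a b} → a ≡ b → qpow a ≗ qpow b
qpow-≗ a≡b i = cong (λ e → qpow e i) a≡b

qpow-+-≡ : ∀ a b {c} → a ℕ.+ b ≡ c → qpow a ⊛ qpow b ≗ qpow c
qpow-+-≡ a b a+b≡c i = trans (qpow-+ a b i) (qpow-≗ a+b≡c i)

infix 4 _≈[_]_ q^_∣_

_≈[_]_ : Series → ℕ → Series → Set
f ≈[ K ] g = ∀ i → i < K → f i ≡ g i

q^_∣_ : ℕ → Series → Set
q^ k ∣ f = f ≈[ k ] zeroSeries

q^k∣qpow-k : ∀ k → q^ k ∣ qpow k
q^k∣qpow-k k i i<k = qpow-≢ (λ i≡k → ℕₚ.<-irrefl i≡k i<k)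

q^∣-≤ : ∀ {a b f} → b ≤ a → q^ a ∣ f → q^ b ∣ f
q^∣-≤ b≤a q^a∣f i i<b = q^a∣f i (ℕₚ.<-≤-trans i<b b≤a)

q^∣-⊛ˡ : ∀ {b g} f → q^ b ∣ g → q^ b ∣ g ⊛ f
q^∣-⊛ˡ {suc b} {g} f q^b∣g zero _ rewrite ⊛-coeff-zero g f | q^b∣g 0 (s≤s z≤n) = refl
q^∣-⊛ˡ {suc b} {g} f q^b∣g (suc i) (s≤s i<b) rewrite ⊛-coeff-suc g f i | q^b∣g 0 (s≤s z≤n) =
  trans (ℤₚ.+-identityˡ _) (q^∣-⊛ˡ f (λ j j<b → q^b∣g (suc j) (s≤s j<b)) i i<b)

q^∣-⊛ʳ : ∀ {b g} f → q^ b ∣ g → q^ b ∣ f ⊛ g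
q^∣-⊛ʳ {g = g} f q^b∣g i i<b = trans (⊛-comm f g i) (q^∣-⊛ˡ f q^b∣g i i<b)

neg : Series → Series
neg f = (- 1ℤ) · f

infixl 6 _⊖_
_⊖_ : Series → Series → Series
f ⊖ g = f ⊕ neg g

1+_ 1−_ : Series → Series
1+ f = one ⊕ f
1− f = one ⊖ f

1−-≗ : ∀ {f g} → f ≗ g → 1− f ≗ 1− g
1−-≗ f≗g i = cong (λ v → one i + (- 1ℤ) * v) (f≗g i)

constantTerm-1− : ∀ f → q^ 1 ∣ f → (1− f) 0 ≡ 1ℤ
constantTerm-1− f q∣f rewrite q∣f 0 (s≤s z≤n) = refl

constantTerm-⊛ : ∀ f g → f 0 ≡ 1ℤ → g 0 ≡ 1ℤ → (f ⊛ g) 0 ≡ 1ℤ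
constantTerm-⊛ f g f₀≡1 g₀≡1 rewrite ⊛-coeff-zero f g | f₀≡1 | g₀≡1 = refl

constantTerm-prodTo : ∀ F → (∀ j → F j 0 ≡ 1ℤ) → ∀ n → prodTo F n 0 ≡ 1ℤ
constantTerm-prodTo F F₀≡1 zero    = refl
constantTerm-prodTo F F₀≡1 (suc n) = constantTerm-⊛ (prodTo F n) (F n) (constantTerm-prodTo F F₀≡1 n) (F₀≡1 n)

prodTo-cong : ∀ {F G} → (∀ j → F j ≗ G j) → ∀ n → prodTo F n ≗ prodTo G n
prodTo-cong F≗G zero    = λ _ → refl
prodTo-cong F≗G (suc n) = ⊛-cong (prodTo-cong F≗G n) (F≗G n)

⊛-1+·qpow-coeff : ∀ f d e {i} → i < e → (f ⊛ (one ⊕ (d · qpow e))) i ≡ f i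
⊛-1+·qpow-coeff f d e {i} i<e = begin
  (f ⊛ (one ⊕ (d · qpow e))) i            ≡⟨ ⊛-comm f (one ⊕ (d · qpow e)) i ⟩
  ((one ⊕ (d · qpow e)) ⊛ f) i            ≡⟨ ⊛-distribʳ-⊕ one (d · qpow e) f i ⟩
  (one ⊛ f) i + ((d · qpow e) ⊛ f) i      ≡⟨ cong₂ _+_ (⊛-identityˡ f i) (·-⊛-assoc d (qpow e) f i) ⟩
  f i + d * (qpow e ⊛ f) i                ≡⟨ cong (λ v → f i + d * v) (q^∣-⊛ˡ f (q^k∣qpow-k e) i i<e) ⟩
  f i + d * 0ℤ                            ≡⟨ cong (f i +_) (ℤₚ.*-zeroʳ d) ⟩
  f i + 0ℤ                                ≡⟨ ℤₚ.+-identityʳ (f i) ⟩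
  f i                                     ∎
  where open ≡-Reasoning

poch-coeff-stable : ∀ c s b {i J} → suc i ≤ J → poch c s (suc b) J i ≡ poch c s (suc b) (suc i) i
poch-coeff-stable c s b {i} {suc J} (s≤s i≤J) with ℕₚ.m≤n⇒m<n∨m≡n i≤J
... | inj₂ refl = refl
... | inj₁ i<J  = trans (⊛-1+·qpow-coeff (poch c s (suc b) J) (- c) (s ℕ.+ suc b ℕ.* J) i<e)
                        (poch-coeff-stable c s b i<J)
  where
  i<e : i < s ℕ.+ suc b ℕ.* J
  i<e = ℕₚ.<-≤-trans (ℕₚ.<-≤-trans (ℕₚ.n<1+n i) i<J)
          (ℕₚ.≤-trans (ℕₚ.m≤m+n J (b ℕ.* J)) (ℕₚ.m≤n+m (suc b ℕ.* J) s))

⊛-congˡ-mod : ∀ {K f f′} g → f ≈[ K ] f′ → f ⊛ g ≈[ K ] f′ ⊛ g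
⊛-congˡ-mod {K} {f} {f′} g f≈f′ zero 0<K = trans (⊛-coeff-zero f g)
  (trans (cong (_* g 0) (f≈f′ 0 0<K)) (sym (⊛-coeff-zero f′ g)))
⊛-congˡ-mod {suc K} {f} {f′} g f≈f′ (suc i) (s≤s i<K) = trans (⊛-coeff-suc f g i)
  (trans (cong₂ (λ a b → a * g (suc i) + b) (f≈f′ 0 (s≤s z≤n))
                (⊛-congˡ-mod g (λ j j<K → f≈f′ (suc j) (s≤s j<K)) i i<K))
         (sym (⊛-coeff-suc f′ g i)))

module Mod-q^ (K : ℕ) where

  infix 4 _≈_
  _≈_ : Series → Series → Set
  f ≈ g = f ≈[ K ] g

  ≗⇒≈ : ∀ {f g} → f ≗ g → f ≈ g
  ≗⇒≈ f≗g i _ = f≗g i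

  ≈-refl : ∀ {f} → f ≈ f
  ≈-refl i _ = refl

  ≈-sym : ∀ {f g} → f ≈ g → g ≈ f
  ≈-sym f≈g i i<K = sym (f≈g i i<K)

  ≈-trans : ∀ {f g h} → f ≈ g → g ≈ h → f ≈ h
  ≈-trans f≈g g≈h i i<K = trans (f≈g i i<K) (g≈h i i<K)

  ⊕-cong-mod : ∀ {f f′ g g′} → f ≈ f′ → g ≈ g′ → f ⊕ g ≈ f′ ⊕ g′
  ⊕-cong-mod f≈f′ g≈g′ i i<K = cong₂ _+_ (f≈f′ i i<K) (g≈g′ i i<K)

  1−-cong-mod : ∀ {f f′} → f ≈ f′ → 1− f ≈ 1− f′
  1−-cong-mod f≈f′ i i<K = cong (λ v → one i + (- 1ℤ) * v) (f≈f′ i i<K)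

  ⊛-cong-mod : ∀ {f f′ g g′} → f ≈ f′ → g ≈ g′ → f ⊛ g ≈ f′ ⊛ g′
  ⊛-cong-mod {f} {f′} {g} {g′} f≈f′ g≈g′ i i<K =
    trans (⊛-congˡ-mod g f≈f′ i i<K)
      (trans (⊛-comm f′ g i) (trans (⊛-congˡ-mod f′ g≈g′ i i<K) (⊛-comm g′ f′ i)))

  neg-cong-mod : ∀ {f f′} → f ≈ f′ → neg f ≈ neg f′
  neg-cong-mod f≈f′ i i<K = cong ((- 1ℤ) *_) (f≈f′ i i<K)

  ring : CommutativeRing 0ℓ 0ℓ
  ring = record
    { Carrier = Series
    ; _≈_ = _≈_
    ; _+_ = _⊕_
    ; _*_ = _⊛_
    ; -_ = neg
    ; 0# = zeroSeries
    ; 1# = one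
    ; isCommutativeRing = record
      { isRing = record
        { +-isAbelianGroup = record
          { isGroup = record
            { isMonoid = record
              { isSemigroup = record
                { isMagma = record
                  { isEquivalence = record { refl = ≈-refl ; sym = ≈-sym ; trans = ≈-trans }
                  ; ∙-cong = ⊕-cong-mod }
                ; assoc = λ f g h i _ → ℤₚ.+-assoc (f i) (g i) (h i) }
              ; identity = (λ f i _ → ℤₚ.+-identityˡ (f i)) , (λ f i _ → ℤₚ.+-identityʳ (f i)) }
            ; inverse = (λ f i _ → neg-inverseˡ (f i)) , (λ f i _ → neg-inverseʳ (f i))
            ; ⁻¹-cong = neg-cong-mod }
          ; comm = λ f g i _ → ℤₚ.+-comm (f i) (g i) }
        ; *-cong = ⊛-cong-mod
        ; *-assoc = λ f g h → ≗⇒≈ (⊛-assoc f g h)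
        ; *-identity = (λ f → ≗⇒≈ (⊛-identityˡ f)) , (λ f → ≗⇒≈ (⊛-identityʳ f))
        ; distrib = (λ f g h i _ → trans (⊛-comm f (g ⊕ h) i)
                                     (trans (⊛-distribʳ-⊕ g h f i) (cong₂ _+_ (⊛-comm g f i) (⊛-comm h f i))))
                  , (λ f g h → ≗⇒≈ (⊛-distribʳ-⊕ g h f)) }
      ; *-comm = λ f g → ≗⇒≈ (⊛-comm f g) }
    }
    where
    neg-inverseˡ : ∀ x → (- 1ℤ) * x + x ≡ 0ℤ
    neg-inverseˡ = solve-∀
    neg-inverseʳ : ∀ x → x + (- 1ℤ) * x ≡ 0ℤ
    neg-inverseʳ = solve-∀

  -- 0 and 1 are sent to zeroSeries and one on the nose, so that the solver's
  -- normal forms of both sides of an identity agree definitionally.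
  constant : ℤ → Series
  constant (ℤ.+ 0) = zeroSeries
  constant (ℤ.+ 1) = one
  constant c       = c · one

  constant≗ : ∀ c → constant c ≗ c · one
  constant≗ (ℤ.+ zero)          n = refl
  constant≗ (ℤ.+ suc zero)      n = sym (ℤₚ.*-identityˡ (one n))
  constant≗ (ℤ.+ suc (suc _))   n = refl
  constant≗ ℤ.-[1+ _ ]          n = refl

  ℤ⟶ring : ℤ.+-*-rawRing ACR.-Raw-AlmostCommutative⟶ ACR.fromCommutativeRing ring
  ℤ⟶ring = record
    { ⟦_⟧ = constant
    ; +-homo = λ a b i _ → trans (constant≗ (a + b) i)
        (trans (ℤₚ.*-distribʳ-+ (one i) a b) (sym (cong₂ _+_ (constant≗ a i) (constant≗ b i))))
    ; *-homo = λ a b i _ → trans (constant≗ (a * b) i) (trans (ℤₚ.*-assoc a b (one i))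
        (sym (trans (⊛-congˡ (constant b) (constant≗ a) i) (trans (·-⊛-assoc a one (constant b) i)
          (cong (a *_) (trans (⊛-identityˡ (constant b) i) (constant≗ b i)))))))
    ; -‿homo = λ a i _ → trans (constant≗ (- a) i)
        (trans (neg-distrib a (one i)) (cong ((- 1ℤ) *_) (sym (constant≗ a i))))
    ; 0-homo = λ i _ → refl
    ; 1-homo = λ i _ → refl
    }
    where
    neg-distrib : ∀ a x → (- a) * x ≡ (- 1ℤ) * (a * x)
    neg-distrib = solve-∀

  _≈?_ : ∀ a b → Maybe (constant a ≈ constant b)
  a ≈? b with a ℤ.≟ b
  ... | yes refl = just ≈-refl
  ... | no _     = nothing

  open import Algebra.Solver.Ring ℤ.+-*-rawRing (ACR.fromCommutativeRing ring) ℤ⟶ring _≈?_ public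

  open CommutativeRing ring using (+-group; zeroʳ; +-identityʳ)
  module ≈-Reasoning = Relation.Binary.Reasoning.Setoid (CommutativeRing.setoid ring)
  open import Algebra.Properties.Group +-group using (x∙y⁻¹≈ε⇒x≈y; x≈y⇒x∙y⁻¹≈ε)

  -- To derive a ≈ b from hypotheses pᵢ ≈ rᵢ, exhibit a − b as a combination
  -- Σ cᵢ (pᵢ − rᵢ); that identity is then a pure ring identity for the solver.
  private
    vanish : ∀ c {p r} → p ≈ r → c ⊛ (p ⊖ r) ≈ zeroSeries
    vanish c p≈r = ≈-trans (⊛-cong-mod (≈-refl {c}) (x≈y⇒x∙y⁻¹≈ε p≈r)) (zeroʳ c)

  by-combination₁ : ∀ {a b} c₁ {p₁ r₁} →
    a ⊖ b ≈ c₁ ⊛ (p₁ ⊖ r₁) → p₁ ≈ r₁ → a ≈ b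
  by-combination₁ c₁ eq h₁ = x∙y⁻¹≈ε⇒x≈y _ _ (≈-trans eq (vanish c₁ h₁))

  by-combination₂ : ∀ {a b} c₁ {p₁ r₁} c₂ {p₂ r₂} →
    a ⊖ b ≈ (c₁ ⊛ (p₁ ⊖ r₁)) ⊕ (c₂ ⊛ (p₂ ⊖ r₂)) →
    p₁ ≈ r₁ → p₂ ≈ r₂ → a ≈ b
  by-combination₂ c₁ c₂ eq h₁ h₂ = x∙y⁻¹≈ε⇒x≈y _ _
    (≈-trans eq (≈-trans (⊕-cong-mod (vanish c₁ h₁) (vanish c₂ h₂)) (+-identityʳ zeroSeries)))

  by-combination₃ : ∀ {a b} c₁ {p₁ r₁} c₂ {p₂ r₂} c₃ {p₃ r₃} →
    a ⊖ b ≈ ((c₁ ⊛ (p₁ ⊖ r₁)) ⊕ (c₂ ⊛ (p₂ ⊖ r₂))) ⊕ (c₃ ⊛ (p₃ ⊖ r₃)) →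
    p₁ ≈ r₁ → p₂ ≈ r₂ → p₃ ≈ r₃ → a ≈ b
  by-combination₃ c₁ c₂ c₃ eq h₁ h₂ h₃ = x∙y⁻¹≈ε⇒x≈y _ _
    (≈-trans eq (≈-trans (⊕-cong-mod (⊕-cong-mod (vanish c₁ h₁) (vanish c₂ h₂)) (vanish c₃ h₃))
                         (≈-trans (+-identityʳ _) (+-identityʳ zeroSeries))))

  ⊛-inverseʳ-mod : ∀ f → f 0 ≡ 1ℤ → f ⊛ inv f ≈ one
  ⊛-inverseʳ-mod f f₀≡1 = ≗⇒≈ (⊛-inverseʳ f f₀≡1)

  ⊛-cancelʳ : ∀ {a b} w → w 0 ≡ 1ℤ → a ⊛ w ≈ b ⊛ w → a ≈ b
  ⊛-cancelʳ {a} {b} w w₀≡1 aw≈bw =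
    by-combination₂ (neg a ⊕ b) (inv w) identity (⊛-inverseʳ-mod w w₀≡1) aw≈bw
    where
    identity = solve 4 (λ a b w w⁻¹ → a :- b
      := ((:- a :+ b) :* ((w :* w⁻¹) :- con 1ℤ)) :+ (w⁻¹ :* ((a :* w) :- (b :* w))))
      ≈-refl a b w (inv w)

  inv-unique : ∀ {f g} → f 0 ≡ 1ℤ → f ⊛ g ≈ one → g ≈ inv f
  inv-unique {f} {g} f₀≡1 fg≈1 = begin
    g                  ≈⟨ solve 1 (λ g → g := g :* con 1ℤ) ≈-refl g ⟩
    g ⊛ one            ≈⟨ ⊛-cong-mod (≈-refl {g}) (≈-sym (⊛-inverseʳ-mod f f₀≡1)) ⟩
    g ⊛ (f ⊛ inv f)    ≈⟨ solve 3 (λ f g h → g :* (f :* h) := (f :* g) :* h) ≈-refl f g (inv f) ⟩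
    (f ⊛ g) ⊛ inv f    ≈⟨ ⊛-cong-mod fg≈1 (≈-refl {inv f}) ⟩
    one ⊛ inv f        ≈⟨ solve 1 (λ h → con 1ℤ :* h := h) ≈-refl (inv f) ⟩
    inv f              ∎
    where open ≈-Reasoning

  inv-cong : ∀ {f g} → f 0 ≡ 1ℤ → g 0 ≡ 1ℤ → f ≈ g → inv f ≈ inv g
  inv-cong {f} {g} f₀≡1 g₀≡1 f≈g =
    inv-unique g₀≡1 (≈-trans (⊛-cong-mod (≈-sym f≈g) (≈-refl {inv f})) (⊛-inverseʳ-mod f f₀≡1))

  inv-⊛ : ∀ {f g} → f 0 ≡ 1ℤ → g 0 ≡ 1ℤ → inv (f ⊛ g) ≈ inv f ⊛ inv g
  inv-⊛ {f} {g} f₀≡1 g₀≡1 = ≈-sym (inv-unique (constantTerm-⊛ f g f₀≡1 g₀≡1) (begin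
    (f ⊛ g) ⊛ (inv f ⊛ inv g)
      ≈⟨ solve 4 (λ f g f⁻¹ g⁻¹ → (f :* g) :* (f⁻¹ :* g⁻¹) := (f :* f⁻¹) :* (g :* g⁻¹))
           ≈-refl f g (inv f) (inv g) ⟩
    (f ⊛ inv f) ⊛ (g ⊛ inv g)
      ≈⟨ ⊛-cong-mod (⊛-inverseʳ-mod f f₀≡1) (⊛-inverseʳ-mod g g₀≡1) ⟩
    one ⊛ one
      ≈⟨ ≗⇒≈ (⊛-identityˡ one) ⟩
    one ∎))
    where open ≈-Reasoning

  ⊛≈⇒≈⊘ : ∀ {r s p} → r 0 ≡ 1ℤ → r ⊛ s ≈ p → s ≈ p ⊘ r
  ⊛≈⇒≈⊘ {r} {s} {p} r₀≡1 rs≈p = begin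
    s                   ≈⟨ solve 1 (λ s → s := s :* con 1ℤ) ≈-refl s ⟩
    s ⊛ one             ≈⟨ ⊛-cong-mod (≈-refl {s}) (≈-sym (⊛-inverseʳ-mod r r₀≡1)) ⟩
    s ⊛ (r ⊛ inv r)     ≈⟨ solve 3 (λ r s h → s :* (r :* h) := (r :* s) :* h) ≈-refl r s (inv r) ⟩
    (r ⊛ s) ⊛ inv r     ≈⟨ ⊛-cong-mod rs≈p (≈-refl {inv r}) ⟩
    p ⊘ r               ∎
    where open ≈-Reasoning

  ⊘-⊘ : ∀ f {g h} → g 0 ≡ 1ℤ → h 0 ≡ 1ℤ → (f ⊘ g) ⊘ h ≈ f ⊘ (h ⊛ g)
  ⊘-⊘ f {g} {h} g₀≡1 h₀≡1 = begin
    (f ⊛ inv g) ⊛ inv h     ≈⟨ solve 3 (λ f a b → (f :* a) :* b := f :* (b :* a)) ≈-refl f (inv g) (inv h) ⟩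
    f ⊛ (inv h ⊛ inv g)     ≈⟨ ⊛-cong-mod (≈-refl {f}) (≈-sym (inv-⊛ h₀≡1 g₀≡1)) ⟩
    f ⊛ inv (h ⊛ g)         ∎
    where open ≈-Reasoning

  ∑ₛ-cong : ∀ {F G} → (∀ n → F n ≈ G n) → ∀ N → ∑ₛ F N ≈ ∑ₛ G N
  ∑ₛ-cong F≈G zero    = ≈-refl
  ∑ₛ-cong F≈G (suc N) = ⊕-cong-mod (∑ₛ-cong F≈G N) (F≈G N)

  ∑ₛ-⊛ʳ : ∀ F g N → ∑ₛ (λ n → F n ⊛ g) N ≈ ∑ₛ F N ⊛ g
  ∑ₛ-⊛ʳ F g zero    = ≗⇒≈ (λ i → sym (⊛-zeroˡ g i))
  ∑ₛ-⊛ʳ F g (suc N) = ≈-trans (⊕-cong-mod (∑ₛ-⊛ʳ F g N) (≈-refl {F N ⊛ g}))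
    (≗⇒≈ (λ i → sym (⊛-distribʳ-⊕ (∑ₛ F N) (F N) g i)))

q q² : Series
q  = qpow 1
q² = qpow 2

x z : ℕ → Series
x n = qpow (2 ℕ.* n)
z k = qpow (2 ℕ.+ 2 ℕ.* k)

∏1+z ∏1−qz : ℕ → Series
∏1+z  = prodTo (λ k → 1+ z k)
∏1−qz = prodTo (λ k → 1− (q ⊛ z k))

numerator denominator : ℕ → ℕ → Series
numerator   k j = (1+ (q ⊛ x j)) ⊛ (z k ⊛ x j)
denominator k j = (1− (q² ⊛ x j)) ⊛ (1− ((q ⊛ z k) ⊛ x j))

-- term k n is u_k(n) of the header.
term : ℕ → ℕ → Series
term k zero    = one
term k (suc n) = (term k n ⊛ numerator k n) ⊛ inv (denominator k n)

x-suc : ∀ n → x (suc n) ≗ q² ⊛ x n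
x-suc n i = trans (cong (λ e → qpow e i) (ℕₚ.*-suc 2 n)) (sym (qpow-+ 2 (2 ℕ.* n) i))

z-suc : ∀ k → z (suc k) ≗ z k ⊛ q²
z-suc k i = trans (cong (λ e → qpow e i) (cong (2 ℕ.+_) (ℕₚ.*-suc 2 k)))
  (trans (cong (λ e → qpow e i) (ℕₚ.+-comm 2 (2 ℕ.+ 2 ℕ.* k))) (sym (qpow-+ (2 ℕ.+ 2 ℕ.* k) 2 i)))

q∣q⊛ : ∀ f → q^ 1 ∣ q ⊛ f
q∣q⊛ f = q^∣-⊛ˡ f (q^k∣qpow-k 1)

constantTerm-denominator : ∀ k n → denominator k n 0 ≡ 1ℤ
constantTerm-denominator k n = constantTerm-⊛ (1− (q² ⊛ x n)) (1− ((q ⊛ z k) ⊛ x n))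
  (constantTerm-1− (q² ⊛ x n) (q^∣-≤ (s≤s z≤n) (q^∣-⊛ˡ (x n) (q^k∣qpow-k 2))))
  (constantTerm-1− ((q ⊛ z k) ⊛ x n) (q^∣-⊛ˡ (x n) (q∣q⊛ (z k))))

q^∣term : ∀ k n → q^ (2 ℕ.+ 2 ℕ.* k ℕ.+ n) ∣ term k (suc n)
q^∣term k n = q^∣-≤ (ℕₚ.+-monoʳ-≤ (2 ℕ.+ 2 ℕ.* k) (ℕₚ.m≤m+n n (n ℕ.+ 0)))
  (q^∣-⊛ˡ (inv (denominator k n)) (q^∣-⊛ʳ (term k n) (q^∣-⊛ʳ (1+ (q ⊛ x n)) q^∣z⊛x)))
  where
  q^∣z⊛x : q^ (2 ℕ.+ 2 ℕ.* k ℕ.+ 2 ℕ.* n) ∣ z k ⊛ x n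
  q^∣z⊛x i i<e = trans (qpow-+ (2 ℕ.+ 2 ℕ.* k) (2 ℕ.* n) i) (q^k∣qpow-k _ i i<e)

q^n∣term : ∀ k n → q^ n ∣ term k n
q^n∣term k zero    i ()
q^n∣term k (suc n) = q^∣-≤ (s≤s (ℕₚ.m≤n+m n (suc (2 ℕ.* k)))) (q^∣term k n)

boundary : ℕ → ℕ → Series
boundary k n = ((1− (q ⊛ z k)) ⊛ (1− x n)) ⊛ term k n

partialSum : ℕ → ℕ → Series
partialSum k = ∑ₛ (term k)

module Recurrences (K : ℕ) where
  open Mod-q^ K

  term-suc : ∀ k n → term k (suc n) ⊛ denominator k n ≈ term k n ⊛ numerator k n
  term-suc k n = by-combination₁ (term k n ⊛ numerator k n) identity
    (⊛-inverseʳ-mod (denominator k n) (constantTerm-denominator k n))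
    where
    identity = solve 3 (λ a d⁻¹ d → ((a :* d⁻¹) :* d) :- a := a :* ((d :* d⁻¹) :- con 1ℤ))
      ≈-refl (term k n ⊛ numerator k n) (inv (denominator k n)) (denominator k n)

  term-suc-index : ∀ k n → term (suc k) n ⊛ (1− ((q ⊛ z k) ⊛ x n)) ≈ (term k n ⊛ x n) ⊛ (1− (q ⊛ z k))
  term-suc-index k zero = solve 2 (λ q z → con 1ℤ :* (con 1ℤ :- ((q :* z) :* con 1ℤ))
                                    := (con 1ℤ :* con 1ℤ) :* (con 1ℤ :- (q :* z))) ≈-refl q (z k)
  -- Multiplied by denominator k n, the step is a combination of term-suc at k and at
  -- suc k and of the induction hypothesis.
  term-suc-index k (suc n) =
    ≈-trans (⊛-cong-mod (≈-refl {A}) (1−-cong-mod (⊛-cong-mod (≈-refl {q ⊛ Z}) xₙ₊₁≈)))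
      (≈-trans main (≈-sym (⊛-cong-mod (⊛-cong-mod (≈-refl {B}) xₙ₊₁≈) (≈-refl {1− (q ⊛ Z)}))))
    where
    A = term (suc k) (suc n)
    B = term k (suc n)
    U = term k n
    V = term (suc k) n
    X = x n
    Z = z k
    xₙ₊₁≈ : x (suc n) ≈ q² ⊛ X
    xₙ₊₁≈ = ≗⇒≈ (x-suc n)
    zₖ₊₁≈ : z (suc k) ≈ Z ⊛ q²
    zₖ₊₁≈ = ≗⇒≈ (z-suc k)
    A-suc : A ⊛ ((1− (q² ⊛ X)) ⊛ (1− ((q ⊛ (Z ⊛ q²)) ⊛ X))) ≈ V ⊛ ((1+ (q ⊛ X)) ⊛ ((Z ⊛ q²) ⊛ X))
    A-suc = ≈-trans
      (⊛-cong-mod (≈-refl {A}) (⊛-cong-mod (≈-refl {1− (q² ⊛ X)})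
        (1−-cong-mod (⊛-cong-mod (⊛-cong-mod (≈-refl {q}) (≈-sym zₖ₊₁≈)) (≈-refl {X})))))
      (≈-trans (term-suc (suc k) n)
        (⊛-cong-mod (≈-refl {V}) (⊛-cong-mod (≈-refl {1+ (q ⊛ X)}) (⊛-cong-mod zₖ₊₁≈ (≈-refl {X})))))
    identity = solve 8 (λ A B U V X Z q q² →
      ((A :* (con 1ℤ :- ((q :* Z) :* (q² :* X)))) :* ((con 1ℤ :- (q² :* X)) :* (con 1ℤ :- ((q :* Z) :* X))))
      :- (((B :* (q² :* X)) :* (con 1ℤ :- (q :* Z))) :* ((con 1ℤ :- (q² :* X)) :* (con 1ℤ :- ((q :* Z) :* X))))
      := (((con 1ℤ :- ((q :* Z) :* X))
             :* ((A :* ((con 1ℤ :- (q² :* X)) :* (con 1ℤ :- ((q :* (Z :* q²)) :* X))))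
                 :- (V :* ((con 1ℤ :+ (q :* X)) :* ((Z :* q²) :* X)))))
         :+ (((con 1ℤ :+ (q :* X)) :* ((Z :* q²) :* X))
             :* ((V :* (con 1ℤ :- ((q :* Z) :* X))) :- ((U :* X) :* (con 1ℤ :- (q :* Z))))))
         :+ ((:- ((q² :* X) :* (con 1ℤ :- (q :* Z))))
             :* ((B :* ((con 1ℤ :- (q² :* X)) :* (con 1ℤ :- ((q :* Z) :* X))))
                 :- (U :* ((con 1ℤ :+ (q :* X)) :* (Z :* X))))))
      ≈-refl A B U V X Z q q²
    main : A ⊛ (1− ((q ⊛ Z) ⊛ (q² ⊛ X))) ≈ (B ⊛ (q² ⊛ X)) ⊛ (1− (q ⊛ Z))
    main = ⊛-cancelʳ (denominator k n) (constantTerm-denominator k n)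
      (by-combination₃ (1− ((q ⊛ Z) ⊛ X)) ((1+ (q ⊛ X)) ⊛ ((Z ⊛ q²) ⊛ X))
                       (neg ((q² ⊛ X) ⊛ (1− (q ⊛ Z))))
        identity A-suc (term-suc-index k n) (term-suc k n))

  term-⊛-∏denominator : ∀ k n → term k n ⊛ prodTo (denominator k) n ≈ prodTo (numerator k) n
  term-⊛-∏denominator k zero    = solve 0 (con 1ℤ :* con 1ℤ := con 1ℤ) ≈-refl
  term-⊛-∏denominator k (suc n) = begin
    term k (suc n) ⊛ (D ⊛ denominator k n)
      ≈⟨ solve 3 (λ t D d → t :* (D :* d) := (t :* d) :* D) ≈-refl (term k (suc n)) D (denominator k n) ⟩
    (term k (suc n) ⊛ denominator k n) ⊛ D
      ≈⟨ ⊛-cong-mod (term-suc k n) (≈-refl {D}) ⟩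
    (term k n ⊛ numerator k n) ⊛ D
      ≈⟨ solve 3 (λ t a D → (t :* a) :* D := (t :* D) :* a) ≈-refl (term k n) (numerator k n) D ⟩
    (term k n ⊛ D) ⊛ numerator k n
      ≈⟨ ⊛-cong-mod (term-⊛-∏denominator k n) (≈-refl {numerator k n}) ⟩
    prodTo (numerator k) n ⊛ numerator k n ∎
    where
    open ≈-Reasoning
    D = prodTo (denominator k) n

  term-telescopes : ∀ k n →
    ((1− (q ⊛ z k)) ⊛ term k n) ⊖ ((1+ z k) ⊛ term (suc k) n) ≈ boundary k n ⊖ boundary k (suc n)
  -- Multiplied by 1 − q z x, this is a combination of term-suc-index and term-suc.
  term-telescopes k n = ≈-trans main
    (⊕-cong-mod (≈-refl {boundary k n}) (neg-cong-mod (⊛-cong-mod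
      (⊛-cong-mod (≈-refl {1− (q ⊛ Z)}) (1−-cong-mod (≈-sym (≗⇒≈ (x-suc n)))))
      (≈-refl {U′}))))
    where
    U = term k n
    U′ = term k (suc n)
    V = term (suc k) n
    X = x n
    Z = z k
    identity = solve 7 (λ U U′ V X Z q q² →
      ((((con 1ℤ :- (q :* Z)) :* U) :- ((con 1ℤ :+ Z) :* V)) :* (con 1ℤ :- ((q :* Z) :* X)))
      :- (((((con 1ℤ :- (q :* Z)) :* (con 1ℤ :- X)) :* U)
          :- (((con 1ℤ :- (q :* Z)) :* (con 1ℤ :- (q² :* X))) :* U′)) :* (con 1ℤ :- ((q :* Z) :* X)))
      := ((:- (con 1ℤ :+ Z)) :* ((V :* (con 1ℤ :- ((q :* Z) :* X))) :- ((U :* X) :* (con 1ℤ :- (q :* Z)))))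
         :+ ((con 1ℤ :- (q :* Z))
             :* ((U′ :* ((con 1ℤ :- (q² :* X)) :* (con 1ℤ :- ((q :* Z) :* X))))
                 :- (U :* ((con 1ℤ :+ (q :* X)) :* (Z :* X))))))
      ≈-refl U U′ V X Z q q²
    main : ((1− (q ⊛ Z)) ⊛ U) ⊖ ((1+ Z) ⊛ V)
           ≈ boundary k n ⊖ (((1− (q ⊛ Z)) ⊛ (1− (q² ⊛ X))) ⊛ U′)
    main = ⊛-cancelʳ (1− ((q ⊛ Z) ⊛ X)) (constantTerm-1− ((q ⊛ Z) ⊛ X) (q^∣-⊛ˡ X (q∣q⊛ Z)))
      (by-combination₂ (neg (1+ Z)) (1− (q ⊛ Z)) identity (term-suc-index k n) (term-suc k n))

  partialSum-recurrence : ∀ k N →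
    ((1− (q ⊛ z k)) ⊛ partialSum k N) ⊖ ((1+ z k) ⊛ partialSum (suc k) N) ≈ neg (boundary k N)
  partialSum-recurrence k zero = solve 2 (λ q Z →
    ((con 1ℤ :- (q :* Z)) :* con 0ℤ) :- ((con 1ℤ :+ Z) :* con 0ℤ)
    := :- (((con 1ℤ :- (q :* Z)) :* (con 1ℤ :- con 1ℤ)) :* con 1ℤ)) ≈-refl q (z k)
  partialSum-recurrence k (suc N) =
    by-combination₂ one one identity (partialSum-recurrence k N) (term-telescopes k N)
    where
    identity = solve 8 (λ q Z S S′ U V w w′ →
      ((((con 1ℤ :- (q :* Z)) :* (S :+ U)) :- ((con 1ℤ :+ Z) :* (S′ :+ V))) :- (:- w′))
      := (con 1ℤ :* ((((con 1ℤ :- (q :* Z)) :* S) :- ((con 1ℤ :+ Z) :* S′)) :- (:- w)))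
         :+ (con 1ℤ :* ((((con 1ℤ :- (q :* Z)) :* U) :- ((con 1ℤ :+ Z) :* V)) :- (w :- w′))))
      ≈-refl q (z k) (partialSum k N) (partialSum (suc k) N) (term k N) (term (suc k) N)
             (boundary k N) (boundary k (suc N))

  partialSum-step : ∀ k →
    (1− (q ⊛ z k)) ⊛ partialSum k K ≈ (1+ z k) ⊛ partialSum (suc k) K
  partialSum-step k = by-combination₁ (neg c) (≈-trans (partialSum-recurrence k K) identity) (q^n∣term k K)
    where
    c = (1− (q ⊛ z k)) ⊛ (1− x K)
    identity = solve 2 (λ c u → :- (c :* u) := (:- c) :* (u :- con 0ℤ)) ≈-refl c (term k K)

  partialSum-iterate : ∀ J → ∏1−qz J ⊛ partialSum 0 K ≈ ∏1+z J ⊛ partialSum J K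
  partialSum-iterate zero    = ≈-refl
  partialSum-iterate (suc J) =
    by-combination₂ (1− (q ⊛ z J)) (∏1+z J) identity (partialSum-iterate J) (partialSum-step J)
    where
    identity = solve 7 (λ R P F G S₀ S S′ → ((R :* F) :* S₀) :- ((P :* G) :* S′)
      := (F :* ((R :* S₀) :- (P :* S))) :+ (P :* ((F :* S) :- (G :* S′))))
      ≈-refl (∏1−qz J) (∏1+z J) (1− (q ⊛ z J)) (1+ z J)
             (partialSum 0 K) (partialSum J K) (partialSum (suc J) K)

  partialSum-top : ∀ n → partialSum K (suc n) ≈ one
  partialSum-top zero    i _ = ℤₚ.+-identityˡ (one i)
  partialSum-top (suc n) = ≈-trans (⊕-cong-mod (partialSum-top n) (q^∣-≤ K≤ (q^∣term K n)))
    (λ i _ → ℤₚ.+-identityʳ (one i))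
    where
    K≤ : K ≤ 2 ℕ.+ 2 ℕ.* K ℕ.+ n
    K≤ = ℕₚ.≤-trans (ℕₚ.m≤m+n K (K ℕ.+ 0))
           (ℕₚ.≤-trans (ℕₚ.m≤n+m (2 ℕ.* K) 2) (ℕₚ.m≤m+n (2 ℕ.+ 2 ℕ.* K) n))

partialSum-diagonal : ∀ K → partialSum K K ≈[ K ] one
partialSum-diagonal zero    i ()
partialSum-diagonal (suc M) = Recurrences.partialSum-top (suc M) M

qpow-triangular : ∀ n → qpow (n ℕ.* suc n) ⊛ (z 0 ⊛ x n) ≗ qpow (suc n ℕ.* suc (suc n))
qpow-triangular n i = begin
  (qpow (n ℕ.* suc n) ⊛ (z 0 ⊛ x n)) i          ≡⟨ ⊛-congʳ (qpow (n ℕ.* suc n)) (qpow-+ 2 (2 ℕ.* n)) i ⟩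
  (qpow (n ℕ.* suc n) ⊛ qpow (2 ℕ.+ 2 ℕ.* n)) i ≡⟨ qpow-+ (n ℕ.* suc n) (2 ℕ.+ 2 ℕ.* n) i ⟩
  qpow (n ℕ.* suc n ℕ.+ (2 ℕ.+ 2 ℕ.* n)) i      ≡⟨ qpow-≗ (exponent n) i ⟩
  qpow (suc n ℕ.* suc (suc n)) i                ∎
  where
  open ≡-Reasoning
  exponent : ∀ n → n ℕ.* suc n ℕ.+ (2 ℕ.+ 2 ℕ.* n) ≡ suc n ℕ.* suc (suc n)
  exponent = ℕ-Solver.solve-∀

∏1+z≗poch : ∀ J → ∏1+z J ≗ poch (- 1ℤ) 2 2 J
∏1+z≗poch = prodTo-cong (λ k i → cong (one i +_) (sym (ℤₚ.*-identityˡ (z k i))))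

poch-q^odd≗ : ∀ J → poch 1ℤ 1 2 (suc J) ≗ (1− q) ⊛ ∏1−qz J
poch-q^odd≗ zero    i = ⊛-comm one (1− q) i
poch-q^odd≗ (suc J) i = begin
  (poch 1ℤ 1 2 (suc J) ⊛ 1− qpow (1 ℕ.+ 2 ℕ.* suc J)) i
    ≡⟨ ⊛-cong (poch-q^odd≗ J) (1−-≗ (λ i → sym (qpow-+-≡ 1 (2 ℕ.+ 2 ℕ.* J) (e J) i))) i ⟩
  (((1− q) ⊛ ∏1−qz J) ⊛ 1− (q ⊛ z J)) i
    ≡⟨ ⊛-assoc (1− q) (∏1−qz J) (1− (q ⊛ z J)) i ⟩
  ((1− q) ⊛ ∏1−qz (suc J)) i ∎
  where
  open ≡-Reasoning
  e : ∀ J → 1 ℕ.+ (2 ℕ.+ 2 ℕ.* J) ≡ 1 ℕ.+ 2 ℕ.* suc J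
  e = ℕ-Solver.solve-∀

lhsTerm : ℕ → Series
lhsTerm n = (qpow (n ℕ.* suc n) ⊛ poch (- 1ℤ) 1 2 n) ⊘ poch 1ℤ 1 1 (suc (2 ℕ.* n))

module Comparison (K : ℕ) where
  open Mod-q^ K
  open Recurrences K
  open ≈-Reasoning

  ∏1−qz₀≡1 : ∏1−qz K 0 ≡ 1ℤ
  ∏1−qz₀≡1 = constantTerm-prodTo _ (λ k → constantTerm-1− (q ⊛ z k) (q∣q⊛ (z k))) K

  constantTerm-∏denominator : ∀ n → prodTo (denominator 0) n 0 ≡ 1ℤ
  constantTerm-∏denominator = constantTerm-prodTo (denominator 0) (constantTerm-denominator 0)

  ∏numerator≈ : ∀ n → prodTo (numerator 0) n ≈ qpow (n ℕ.* suc n) ⊛ poch (- 1ℤ) 1 2 n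
  ∏numerator≈ zero    = solve 0 (con 1ℤ := con 1ℤ :* con 1ℤ) ≈-refl
  ∏numerator≈ (suc n) = begin
    prodTo (numerator 0) n ⊛ ((1+ (q ⊛ x n)) ⊛ (z 0 ⊛ x n))
      ≈⟨ ⊛-cong-mod (∏numerator≈ n) ≈-refl ⟩
    (qpow (n ℕ.* suc n) ⊛ P) ⊛ ((1+ (q ⊛ x n)) ⊛ (z 0 ⊛ x n))
      ≈⟨ solve 5 (λ a p f z x → (a :* p) :* ((con 1ℤ :+ f) :* (z :* x)) := (a :* (z :* x)) :* (p :* (con 1ℤ :+ f)))
           ≈-refl (qpow (n ℕ.* suc n)) P (q ⊛ x n) (z 0) (x n) ⟩
    (qpow (n ℕ.* suc n) ⊛ (z 0 ⊛ x n)) ⊛ (P ⊛ (1+ (q ⊛ x n)))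
      ≈⟨ ⊛-cong-mod (≗⇒≈ (qpow-triangular n)) (⊛-cong-mod (≈-refl {P}) (≗⇒≈ factor)) ⟩
    qpow (suc n ℕ.* suc (suc n)) ⊛ poch (- 1ℤ) 1 2 (suc n) ∎
    where
    P = poch (- 1ℤ) 1 2 n
    factor : 1+ (q ⊛ x n) ≗ one ⊕ ((- (- 1ℤ)) · qpow (1 ℕ.+ 2 ℕ.* n))
    factor i = cong (one i +_) (trans (qpow-+ 1 (2 ℕ.* n) i) (sym (ℤₚ.*-identityˡ _)))

  poch-odd≈ : ∀ n → poch 1ℤ 1 1 (suc (2 ℕ.* n)) ≈ (1− q) ⊛ prodTo (denominator 0) n
  poch-odd≈ zero    = solve 1 (λ q → con 1ℤ :* (con 1ℤ :- q) := (con 1ℤ :- q) :* con 1ℤ) ≈-refl q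
  poch-odd≈ (suc n) = begin
    poch 1ℤ 1 1 (suc (2 ℕ.* suc n))
      ≈⟨ ≗⇒≈ (λ i → cong (λ k → poch 1ℤ 1 1 k i) (index n)) ⟩
    (P ⊛ 1− qpow (1 ℕ.+ 1 ℕ.* suc (2 ℕ.* n))) ⊛ 1− qpow (1 ℕ.+ 1 ℕ.* suc (suc (2 ℕ.* n)))
      ≈⟨ ⊛-cong-mod (⊛-cong-mod (poch-odd≈ n) (≗⇒≈ (1−-≗ (sym ∘ q²x≗ n))))
                    (≗⇒≈ (1−-≗ (sym ∘ qzx≗ n))) ⟩
    (((1− q) ⊛ D) ⊛ 1− (q² ⊛ x n)) ⊛ 1− ((q ⊛ z 0) ⊛ x n)
      ≈⟨ solve 4 (λ f D a b → ((f :* D) :* a) :* b := f :* (D :* (a :* b)))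
           ≈-refl (1− q) D (1− (q² ⊛ x n)) (1− ((q ⊛ z 0) ⊛ x n)) ⟩
    (1− q) ⊛ (D ⊛ denominator 0 n) ∎
    where
    P = poch 1ℤ 1 1 (suc (2 ℕ.* n))
    D = prodTo (denominator 0) n
    index : ∀ n → suc (2 ℕ.* suc n) ≡ suc (suc (suc (2 ℕ.* n)))
    index = ℕ-Solver.solve-∀
    q²x≗ : ∀ n → q² ⊛ x n ≗ qpow (1 ℕ.+ 1 ℕ.* suc (2 ℕ.* n))
    q²x≗ n = qpow-+-≡ 2 (2 ℕ.* n) (e n)
      where
      e : ∀ n → 2 ℕ.+ 2 ℕ.* n ≡ 1 ℕ.+ 1 ℕ.* suc (2 ℕ.* n)
      e = ℕ-Solver.solve-∀
    qzx≗ : ∀ n → (q ⊛ z 0) ⊛ x n ≗ qpow (1 ℕ.+ 1 ℕ.* suc (suc (2 ℕ.* n)))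
    qzx≗ n i = trans (⊛-congˡ (x n) (qpow-+ 1 2) i) (qpow-+-≡ 3 (2 ℕ.* n) (e n) i)
      where
      e : ∀ n → 3 ℕ.+ 2 ℕ.* n ≡ 1 ℕ.+ 1 ℕ.* suc (suc (2 ℕ.* n))
      e = ℕ-Solver.solve-∀

  lhsTerm≈ : ∀ n → lhsTerm n ≈ term 0 n ⊘ (1− q)
  lhsTerm≈ n = begin
    (qpow (n ℕ.* suc n) ⊛ poch (- 1ℤ) 1 2 n) ⊛ inv (poch 1ℤ 1 1 (suc (2 ℕ.* n)))
      ≈⟨ ⊛-cong-mod (≈-sym (∏numerator≈ n))
           (inv-cong (constantTerm-prodTo _ (λ _ → refl) (suc (2 ℕ.* n)))
                     (constantTerm-⊛ (1− q) D refl D₀≡1) (poch-odd≈ n)) ⟩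
    prodTo (numerator 0) n ⊛ inv ((1− q) ⊛ D)
      ≈⟨ ⊛-cong-mod (≈-sym (term-⊛-∏denominator 0 n)) (inv-⊛ refl D₀≡1) ⟩
    (term 0 n ⊛ D) ⊛ (inv (1− q) ⊛ inv D)
      ≈⟨ solve 4 (λ t D a b → (t :* D) :* (a :* b) := (t :* a) :* (D :* b))
           ≈-refl (term 0 n) D (inv (1− q)) (inv D) ⟩
    (term 0 n ⊘ (1− q)) ⊛ (D ⊛ inv D)
      ≈⟨ ⊛-cong-mod (≈-refl {term 0 n ⊘ (1− q)}) (⊛-inverseʳ-mod D D₀≡1) ⟩
    (term 0 n ⊘ (1− q)) ⊛ one
      ≈⟨ ≗⇒≈ (⊛-identityʳ (term 0 n ⊘ (1− q))) ⟩
    term 0 n ⊘ (1− q) ∎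
    where
    D = prodTo (denominator 0) n
    D₀≡1 = constantTerm-∏denominator n

  pochInf≈poch : ∀ c s b {J} → K ≤ J → pochInf c s (suc b) ≈ poch c s (suc b) J
  pochInf≈poch c s b K≤J i i<K = sym (poch-coeff-stable c s b (ℕₚ.≤-trans i<K K≤J))

  rhs≈ : rhs ≈ ∏1+z K ⊘ ((1− q) ⊛ ∏1−qz K)
  rhs≈ = ⊛-cong-mod (≈-trans (pochInf≈poch (- 1ℤ) 2 1 ℕₚ.≤-refl) (≗⇒≈ (λ i → sym (∏1+z≗poch K i))))
    (inv-cong (constantTerm-prodTo (λ j → 1− qpow (1 ℕ.+ 2 ℕ.* j)) (λ _ → refl) 1)
              (constantTerm-⊛ (1− q) (∏1−qz K) refl ∏1−qz₀≡1)
              (≈-trans (pochInf≈poch 1ℤ 1 1 (ℕₚ.n≤1+n K)) (≗⇒≈ (poch-q^odd≗ K))))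

  partialSum≈ : partialSum 0 K ≈ ∏1+z K ⊘ ∏1−qz K
  partialSum≈ = ⊛≈⇒≈⊘ ∏1−qz₀≡1 (≈-trans (partialSum-iterate K)
    (≈-trans (⊛-cong-mod (≈-refl {∏1+z K}) (partialSum-diagonal K)) (≗⇒≈ (⊛-identityʳ (∏1+z K)))))

  ∑lhsTerm≈rhs : ∑ₛ lhsTerm K ≈ rhs
  ∑lhsTerm≈rhs = begin
    ∑ₛ lhsTerm K                     ≈⟨ ∑ₛ-cong lhsTerm≈ K ⟩
    ∑ₛ (λ n → term 0 n ⊘ (1− q)) K   ≈⟨ ∑ₛ-⊛ʳ (term 0) (inv (1− q)) K ⟩
    partialSum 0 K ⊘ (1− q)          ≈⟨ ⊛-cong-mod partialSum≈ (≈-refl {inv (1− q)}) ⟩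
    (∏1+z K ⊘ ∏1−qz K) ⊘ (1− q)      ≈⟨ ⊘-⊘ (∏1+z K) {∏1−qz K} {1− q} ∏1−qz₀≡1 refl ⟩
    ∏1+z K ⊘ ((1− q) ⊛ ∏1−qz K)      ≈⟨ ≈-sym rhs≈ ⟩
    rhs                              ∎

corollary2p12 : (m : ℕ) → lhs m ≡ rhs m
corollary2p12 m = trans (sumSeries≡∑ₛ lhsTerm m) (Comparison.∑lhsTerm≈rhs (suc m) m (ℕₚ.n<1+n m))
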